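{- Let $T$ be a tree with $k$ edges, let $x_0,\dots,x_k$ be a leaf ordering of $V(T)$, and let $e_i=x_{i'}x_i$ for $1\le i\le k$, where $x_{i'}$ is the unique neighbor of $x_i$ preceding it. Let $H_0$ be a graph on vertex set $\{e_1,\dots,e_k\}$ such that for every $j\in[k]$, $$|\{i<j : e_ie_j\in E(H_0)\}|\le k-j.$$ Let $H$ be obtained from $H_0$ by adding all edges $e_ie_j$ with $i\ne j$ and $e_i\cap e_j\neq\emptyset$. Suppose that for every path in $T$ of length $2\ell$, with edges $e_{i_1},\dots,e_{i_{2\ell}}$, the subgraph of $H$ induced on $\{e_{i_1},\dots,e_{i_{2\ell}}\}$ has chromatic number at least $\ell+1$. Then $\delta^*(Q_n,T)\le k-1$ for every $n$.
   Context: A leaf ordering of a tree $T$ on vertices $x_0,\dots,x_k$ is an ordering such that for every $1\le i\le k$, $x_i$ has exactly one neighbor among $x_0,\dots,x_{i-1}$. $Q_n$ has vertex set $\{0,1\}^n$, with $x,y$ adjacent iff they differ in exactly one coordinate. A proper edge coloring assigns colors to edges so that edges sharing a vertex get different colors; a subgraph is rainbow if its edges have distinct colors. $\delta^*(G,F)$ is the maximum of $\delta(H')$ over subgraphs $H'\subseteq G$ admitting a proper edge coloring with no rainbow subgraph isomorphic to $F$. -}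

module Defs where

open import Data.Nat using (ℕ; zero; suc; _≤_; _<_; _∸_; _+_; _*_)
open import Data.Fin using (Fin; toℕ; fromℕ; inject₁) renaming (zero to fzero; suc to fsuc)
open import Data.Bool using (Bool; true; false; not; if_then_else_)
open import Data.Vec using (Vec; _[_]%=_)
open import Data.Product using (Σ; _×_; _,_; ∃)
open import Data.Sum using (_⊎_)
open import Relation.Nullary using (¬_)
open import Relation.Binary.PropositionalEquality using (_≡_; _≢_)

count : (m : ℕ) → (Fin m → Bool) → ℕ
count zero    p = 0
count (suc m) p = (if p fzero then 1 else 0) + count m (λ i → p (fsuc i))

-- The tree T, on vertex set {x_0,…,x_k} = Fin (suc k), x_i = i.
-- Adj is its (Set-valued) adjacency relation.

module TreeDefs {k : ℕ} (Adj : Fin (suc k) → Fin (suc k) → Set) where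

  IsSimpleGraph : Set
  IsSimpleGraph = (∀ u v → Adj u v → Adj v u) × (∀ u → ¬ Adj u u)

  IsPath : (L : ℕ) → (Fin (suc L) → Fin (suc k)) → Set
  IsPath L v = (∀ a b → v a ≡ v b → a ≡ b)
             × (∀ (a : Fin L) → Adj (v (inject₁ a)) (v (fsuc a)))

  Connected : Set
  Connected = ∀ u w → Σ ℕ λ L → Σ (Fin (suc L) → Fin (suc k)) λ v →
                IsPath L v × (v fzero ≡ u) × (v (fromℕ L) ≡ w)

  Acyclic : Set
  Acyclic = ∀ L → 2 ≤ L → (v : Fin (suc L) → Fin (suc k)) →
              IsPath L v → ¬ Adj (v (fromℕ L)) (v fzero)

  IsTree : Set
  IsTree = IsSimpleGraph × Connected × Acyclic

  IsLeafOrdering : Set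
  IsLeafOrdering = ∀ (i : Fin k) →
    Σ (Fin (suc k)) λ p → (toℕ p < toℕ (fsuc i)) × Adj p (fsuc i)
      × (∀ q → toℕ q < toℕ (fsuc i) → Adj q (fsuc i) → q ≡ p)

  -- Edges e_1,…,e_k are indexed by i : Fin k (index i stands for e_{i+1}).
  -- e_{i+1} = x_{(i+1)'} x_{i+1}; w ∈ e_{i+1} iff w = x_{i+1} or w is the
  -- (unique) neighbour of x_{i+1} preceding it.
  _∈e_ : Fin (suc k) → Fin k → Set
  w ∈e i = (w ≡ fsuc i) ⊎ ((toℕ w < toℕ (fsuc i)) × Adj w (fsuc i))

  Meet : Fin k → Fin k → Set
  Meet i j = ∃ λ w → (w ∈e i) × (w ∈e j)

  module HDefs (H₀ : Fin k → Fin k → Bool) where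

    H₀Graph : Set
    H₀Graph = (∀ i j → H₀ i j ≡ H₀ j i) × (∀ i → H₀ i i ≡ false)

    -- for every j ∈ [k]: |{ i < j : e_i e_j ∈ E(H₀) }| ≤ k - j
    -- (0-based index j stands for e_{j+1})
    DegreeCondition : Set
    DegreeCondition = ∀ (j : Fin k) →
      count k (λ i → if Data.Nat._<ᵇ_ (toℕ i) (toℕ j) then H₀ i j else false)
        ≤ k ∸ suc (toℕ j)

    HAdj : Fin k → Fin k → Set
    HAdj i j = (H₀ i j ≡ true) ⊎ ((i ≢ j) × Meet i j)

    EdgeAt : (L : ℕ) → (Fin (suc L) → Fin (suc k)) → Fin L → Fin k → Set
    EdgeAt L v a i = (v (inject₁ a) ∈e i) × (v (fsuc a) ∈e i)

    PathEdgesColourable : (L : ℕ) → (Fin (suc L) → Fin (suc k)) → ℕ → Set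
    PathEdgesColourable L v c = Σ (Fin L → Fin c) λ col →
      ∀ a b i j → a ≢ b → EdgeAt L v a i → EdgeAt L v b j → HAdj i j →
        col a ≢ col b

    ChromaticCondition : Set
    ChromaticCondition = ∀ ℓ → 1 ≤ ℓ → (v : Fin (suc (2 * ℓ)) → Fin (suc k)) →
      IsPath (2 * ℓ) v → ¬ PathEdgesColourable (2 * ℓ) v ℓ

-- The hypercube Q_n: vertices Vec Bool n; the edges at x are {x, flip x d}.

Cube : ℕ → Set
Cube n = Vec Bool n

flip : ∀ {n} → Cube n → Fin n → Cube n
flip x d = x [ d ]%= not

-- A subgraph H' = (V', E') of Q_n: E' x d = true means {x, flip x d} ∈ E(H').
module SubcubeDefs {n : ℕ} (V' : Cube n → Bool) (E' : Cube n → Fin n → Bool) where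

  IsSubgraph : Set
  IsSubgraph = (∀ x d → E' x d ≡ E' (flip x d) d)
             × (∀ x d → E' x d ≡ true → V' x ≡ true)

  degree : Cube n → ℕ
  degree x = count n (E' x)

  module ColDefs {C : Set} (c : Cube n → Fin n → C) where

    WellDefined : Set
    WellDefined = ∀ x d → E' x d ≡ true → c x d ≡ c (flip x d) d

    Proper : Set
    Proper = ∀ x d d' → d ≢ d' → E' x d ≡ true → E' x d' ≡ true → c x d ≢ c x d'

    RainbowCopy : {k : ℕ} → (Fin (suc k) → Fin (suc k) → Set) → Set
    RainbowCopy {k} Adj = Σ (Fin (suc k) → Cube n) λ φ →
        (∀ u w → φ u ≡ φ w → u ≡ w)
      × (∀ u w → Adj u w → Σ (Fin n) λ d → (φ w ≡ flip (φ u) d) × (E' (φ u) d ≡ true))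
      × (∀ u w u' w' d d' → Adj u w → Adj u' w' →
           ¬ (((u ≡ u') × (w ≡ w')) ⊎ ((u ≡ w') × (w ≡ u'))) →
           φ w ≡ flip (φ u) d → φ w' ≡ flip (φ u') d' →
           c (φ u) d ≢ c (φ u') d')

-- If some vertex of H' has degree below k we are done, so assume all degrees are at least k
-- and embed T greedily along the leaf ordering.  The edge e_j is mapped to an edge of H' at the
-- image of x_{j'} whose colour differs from the j - 1 colours used so far and whose direction
-- differs from those of the at most k - j earlier H₀-neighbours of e_j; since the degree is at
-- least k such an edge exists.  The resulting copy of T is rainbow, and it is injective: if two
-- vertices had the same image, the tree path between them would map to a closed walk in Q_n.
-- Such a walk uses each direction an even number of times, so the path has length 2ℓ and its
-- edges carry at most ℓ directions.  Colouring the path edges by direction is proper for H: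
-- H₀-adjacent edges received distinct directions, and two intersecting edges with the same
-- direction would have the same colour at their common vertex.  This contradicts the
-- chromatic condition.

module Submission where

open import Defs
open import Level using (0ℓ)
open import Data.Nat using (ℕ; zero; suc; _+_; _*_; _∸_; _≤_; _<_; z≤n; s≤s; _<ᵇ_; _<?_)
open import Data.Nat.Properties
  using ( ≤-refl; ≤-trans; ≤-reflexive; ≤-pred; <⇒≤; <⇒≢; <-irrefl; <-cmp; ≤∧≢⇒<; ≮⇒≥
        ; n≤1+n; n<1+n; 1+n≰n; 1+n≢n; m≤n⇒m≤1+n; m<n⇒m<1+n; m<n⇒0<n; +-suc; +-mono-≤
        ; m+[n∸m]≡n; <⇒<ᵇ; module ≤-Reasoning )
open import Data.Fin using (Fin; toℕ; fromℕ; inject₁; fromℕ<) renaming (zero to fzero; suc to fsuc)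
open import Data.Fin.Properties using (_≟_; toℕ<n; toℕ-injective; toℕ-inject₁; toℕ-fromℕ<)
open import Data.Fin.Subset.Properties using (anySubset?)
open import Data.Bool using (Bool; true; false; not; _xor_; if_then_else_)
open import Data.Bool.Properties
  using (not-¬; not-injective; not-involutive; xor-same; xor-assoc; T-≡)
  renaming (_≟_ to _≟ᵇ_)
open import Data.Maybe using (Maybe; just; nothing; is-just; map)
open import Data.Maybe.Relation.Unary.Any using (just) renaming (Any to MaybeAny)
open import Data.List using (List; []; _∷_; length; tabulate; catMaybes; foldl; _++_)
open import Data.List.Properties
  using (Any-catMaybes⁺; length-++; length-tabulate; length-removeAt′)
open import Data.List.Relation.Unary.Any using (here; there; _─_)
open import Data.List.Relation.Unary.Any.Properties using (tabulate⁺)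
open import Data.List.Membership.Propositional using (_∈_; _∉_)
open import Data.List.Membership.Propositional.Properties using (∈-++⁺ˡ; ∈-++⁺ʳ)
open import Data.Vec using (lookup)
open import Data.Vec.Properties
  using (lookup∘updateAt; lookup∘updateAt′; updateAt-updateAt-local; updateAt-id)
open import Data.Vec.Functional using (updateAt)
open import Data.Vec.Functional.Properties using (updateAt-updates; updateAt-minimal)
open import Data.Product using (Σ; ∃; _×_; _,_; proj₁; proj₂)
open import Data.Sum using (_⊎_; inj₁; inj₂)
open import Data.Empty using (⊥-elim)
open import Function using (_∘_; const; Equivalence)
open import Effect.Monad using (RawMonad)
open import Relation.Nullary using (¬_; Dec; yes; no; does; contradiction)
open import Relation.Nullary.Decidable using (dec⇒maybe; ¬¬-excluded-middle; _×-dec_)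
open import Relation.Nullary.Negation using (¬¬-Monad; ¬¬-map)
open import Relation.Binary.Definitions using (tri<; tri≈; tri>)
open import Relation.Binary.PropositionalEquality

open RawMonad (¬¬-Monad {0ℓ}) using (pure; _>>=_)

count-mono : ∀ m {p q : Fin m → Bool} → (∀ i → p i ≡ true → q i ≡ true) →
  count m p ≤ count m q
count-mono zero p⇒q = z≤n
count-mono (suc m) {p} {q} p⇒q with p fzero in p₀ | q fzero in q₀
... | false | false = count-mono m (p⇒q ∘ fsuc)
... | false | true  = m≤n⇒m≤1+n (count-mono m (p⇒q ∘ fsuc))
... | true  | true  = s≤s (count-mono m (p⇒q ∘ fsuc))
... | true  | false = contradiction (trans (sym q₀) (p⇒q fzero p₀)) λ ()

count-pos : ∀ m (p : Fin m → Bool) → 0 < count m p → ∃ λ i → p i ≡ true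
count-pos (suc m) p pos with p fzero in p₀
... | true  = fzero , p₀
... | false = let i , pi = count-pos m (p ∘ fsuc) pos in fsuc i , pi

count-<ᵇ : ∀ m J → J ≤ m → count m (λ t → toℕ t <ᵇ J) ≡ J
count-<ᵇ zero    zero    _ = refl
count-<ᵇ (suc m) zero    _ = count-<ᵇ m zero z≤n
count-<ᵇ (suc m) (suc J) (s≤s J≤m) = cong suc (count-<ᵇ m J J≤m)

<⇒<ᵇ≡true : ∀ {m n} → m < n → (m <ᵇ n) ≡ true
<⇒<ᵇ≡true = Equivalence.to T-≡ ∘ <⇒<ᵇ

_without_ : ∀ {n} → (Fin n → Bool) → Fin n → Fin n → Bool
(A without x) d = if does (d ≟ x) then false else A d

count-without : ∀ {n} (A : Fin n → Bool) x → count n A ≤ suc (count n (A without x))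
count-without {suc n} A fzero with A fzero
... | true  = ≤-refl
... | false = n≤1+n _
count-without {suc n} A (fsuc x) with A fzero
... | true  = s≤s (count-without (A ∘ fsuc) x)
... | false = count-without (A ∘ fsuc) x

without-true : ∀ {n} (A : Fin n → Bool) x d → (A without x) d ≡ true → A d ≡ true × d ≢ x
without-true A x d Ad with d ≟ x
... | yes _   = contradiction Ad λ ()
... | no d≢x = Ad , d≢x

pigeonhole : ∀ {n} (A : Fin n → Bool) (xs : List (Fin n)) → length xs < count n A →
  ∃ λ d → A d ≡ true × d ∉ xs
pigeonhole A [] pos = let d , Ad = count-pos _ A pos in d , Ad , λ ()
pigeonhole A (x ∷ xs) lt
  with pigeonhole (A without x) xs (≤-pred (≤-trans lt (count-without A x)))
... | d , A'd , d∉xs with without-true A x d A'd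
...   | Ad , d≢x = d , Ad , λ { (here d≡x) → d≢x d≡x ; (there d∈xs) → d∉xs d∈xs }

length-catMaybes-tabulate : ∀ {A : Set} m (f : Fin m → Maybe A) →
  length (catMaybes (tabulate f)) ≡ count m (is-just ∘ f)
length-catMaybes-tabulate zero    f = refl
length-catMaybes-tabulate (suc m) f with f fzero
... | just _  = cong suc (length-catMaybes-tabulate m (f ∘ fsuc))
... | nothing = length-catMaybes-tabulate m (f ∘ fsuc)

∈-catMaybes-tabulate : ∀ {A : Set} {m} (f : Fin m → Maybe A) {x} i → f i ≡ just x →
  x ∈ catMaybes (tabulate f)
∈-catMaybes-tabulate f i fi≡x =
  Any-catMaybes⁺ (tabulate⁺ i (subst (MaybeAny (_ ≡_)) (sym fi≡x) (just refl)))

is-just-guarded : ∀ {A : Set} b {m : Maybe A} → is-just (if b then m else nothing) ≡ true → b ≡ true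
is-just-guarded true  _ = refl
is-just-guarded false ()

lookup-flip : ∀ {n} (x : Cube n) d e → lookup (flip x d) e ≡ does (d ≟ e) xor lookup x e
lookup-flip x d e with d ≟ e
... | yes refl = lookup∘updateAt d x
... | no d≢e  = lookup∘updateAt′ e d (d≢e ∘ sym) x

flip-involutive : ∀ {n} (x : Cube n) d → flip (flip x d) d ≡ x
flip-involutive x d =
  trans (updateAt-updateAt-local d x (not-involutive _)) (updateAt-id d x)

flip-sym : ∀ {n} {x y : Cube n} d → y ≡ flip x d → x ≡ flip y d
flip-sym {x = x} d refl = sym (flip-involutive x d)

flip-injective : ∀ {n} (x : Cube n) {d d'} → flip x d ≡ flip x d' → d ≡ d'
flip-injective x {d} {d'} eq with d ≟ d'
... | yes d≡d' = d≡d'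
... | no d≢d' = ⊥-elim (not-¬ refl (sym not-fixed))
  where
  not-fixed : not (lookup x d) ≡ lookup x d
  not-fixed = begin
    not (lookup x d)      ≡⟨ lookup∘updateAt d x ⟨
    lookup (flip x d) d   ≡⟨ cong (λ z → lookup z d) eq ⟩
    lookup (flip x d') d  ≡⟨ lookup∘updateAt′ d d' d≢d' x ⟩
    lookup x d            ∎
    where open ≡-Reasoning

xor-swap : ∀ a b c → a xor (b xor c) ≡ b xor (a xor c)
xor-swap false b     c = refl
xor-swap true  false c = refl
xor-swap true  true  c = refl

xor-fixed : ∀ a b → a xor b ≡ b → a ≡ false
xor-fixed false _ _  = refl
xor-fixed true  _ eq = ⊥-elim (not-¬ refl (sym eq))

occursOddly : ∀ {n} → Fin n → List (Fin n) → Bool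
occursOddly e []       = false
occursOddly e (d ∷ ds) = does (d ≟ e) xor occursOddly e ds

EvenOccurrences : ∀ {n} → List (Fin n) → Set
EvenOccurrences ds = ∀ e → occursOddly e ds ≡ false

lookup-walk : ∀ {n} (x : Cube n) ds e → lookup (foldl flip x ds) e ≡ occursOddly e ds xor lookup x e
lookup-walk x []       e = refl
lookup-walk x (d ∷ ds) e = begin
  lookup (foldl flip (flip x d) ds) e
    ≡⟨ lookup-walk (flip x d) ds e ⟩
  occursOddly e ds xor lookup (flip x d) e
    ≡⟨ cong (occursOddly e ds xor_) (lookup-flip x d e) ⟩
  occursOddly e ds xor (does (d ≟ e) xor lookup x e)
    ≡⟨ xor-swap (occursOddly e ds) (does (d ≟ e)) (lookup x e) ⟩
  does (d ≟ e) xor (occursOddly e ds xor lookup x e)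
    ≡⟨ xor-assoc (does (d ≟ e)) _ _ ⟨
  (does (d ≟ e) xor occursOddly e ds) xor lookup x e
    ∎
  where open ≡-Reasoning

closed-walk⇒even : ∀ {n} (x : Cube n) ds → foldl flip x ds ≡ x → EvenOccurrences ds
closed-walk⇒even x ds closed e =
  xor-fixed (occursOddly e ds) (lookup x e)
    (trans (sym (lookup-walk x ds e)) (cong (λ z → lookup z e) closed))

walk-along : ∀ {n} L (ψ : Fin (suc L) → Cube n) (ds : Fin L → Fin n) →
  (∀ a → ψ (fsuc a) ≡ flip (ψ (inject₁ a)) (ds a)) →
  ψ (fromℕ L) ≡ foldl flip (ψ fzero) (tabulate ds)
walk-along zero    ψ ds step = refl
walk-along (suc L) ψ ds step = trans (walk-along L (ψ ∘ fsuc) (ds ∘ fsuc) (step ∘ fsuc))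
  (cong (λ z → foldl flip z (tabulate (ds ∘ fsuc))) (step fzero))

odd⇒∈ : ∀ {n} {e : Fin n} ds → occursOddly e ds ≡ true → e ∈ ds
odd⇒∈ {e = e} (d ∷ ds) odd with d ≟ e
... | yes d≡e = here (sym d≡e)
... | no _    = there (odd⇒∈ ds odd)

occursOddly-─ : ∀ {n} {d : Fin n} {ds} e (d∈ds : d ∈ ds) →
  occursOddly e (ds ─ d∈ds) ≡ does (d ≟ e) xor occursOddly e ds
occursOddly-─ {d = d} {_ ∷ ds} e (here refl) = sym (begin
  b xor (b xor occursOddly e ds)  ≡⟨ xor-assoc b b _ ⟨
  (b xor b) xor occursOddly e ds  ≡⟨ cong (_xor occursOddly e ds) (xor-same b) ⟩
  occursOddly e ds                ∎)
  where open ≡-Reasoning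
        b = does (d ≟ e)
occursOddly-─ {d = d} {x ∷ ds} e (there d∈ds) =
  trans (cong (does (x ≟ e) xor_) (occursOddly-─ e d∈ds))
        (xor-swap (does (x ≟ e)) (does (d ≟ e)) (occursOddly e ds))

∈-─ : ∀ {n} {d e : Fin n} {ds} → e ∈ ds → (d∈ds : d ∈ ds) → e ≢ d → e ∈ (ds ─ d∈ds)
∈-─ (here refl)  (here refl)  e≢d = contradiction refl e≢d
∈-─ (there e∈ds) (here refl)  _   = e∈ds
∈-─ (here refl)  (there d∈ds) _   = here refl
∈-─ (there e∈ds) (there d∈ds) e≢d = there (∈-─ e∈ds d∈ds e≢d)

record Halvable {n} (ds : List (Fin n)) : Set where
  field
    half            : ℕ
    length≡         : length ds ≡ 2 * half
    label           : Fin n → ℕ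
    label<          : ∀ {e} → e ∈ ds → label e < half
    label-injective : ∀ {e e'} → e ∈ ds → e' ∈ ds → label e ≡ label e' → e ≡ e'

-- Remove the head and a second copy of it, then give the head a fresh label.
even⇒halvable : ∀ {n} (ds : List (Fin n)) → EvenOccurrences ds → Halvable ds
even⇒halvable ds = go (length ds) ds ≤-refl
  where
  go : ∀ {n} m (ds : List (Fin n)) → length ds ≤ m → EvenOccurrences ds → Halvable ds
  go _ [] _ _ = record
    { half = 0 ; length≡ = refl ; label = λ _ → 0 ; label< = λ () ; label-injective = λ () }
  go {n} (suc m) (d ∷ ds) (s≤s ∣ds∣≤m) even = record
    { half = suc h ; length≡ = length≡′
    ; label = label′ ; label< = label<′ ; label-injective = injective }
    where
    d-odd : occursOddly d ds ≡ true
    d-odd with d ≟ d | even d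
    ... | yes _   | ¬odd = not-injective ¬odd
    ... | no d≢d | _    = contradiction refl d≢d
    d∈ds : d ∈ ds
    d∈ds = odd⇒∈ ds d-odd
    rest : List (Fin n)
    rest = ds ─ d∈ds
    ∣ds∣≡ : length ds ≡ suc (length rest)
    ∣ds∣≡ = length-removeAt′ ds _
    H : Halvable rest
    H = go m rest (≤-trans (n≤1+n _) (subst (_≤ m) ∣ds∣≡ ∣ds∣≤m))
           λ e → trans (occursOddly-─ e d∈ds) (even e)
    open Halvable H
    h : ℕ
    h = half
    length≡′ : suc (length ds) ≡ 2 * suc h
    length≡′ = cong suc (trans ∣ds∣≡ (trans (cong suc length≡) (sym (+-suc h (h + 0)))))
    ∈rest : ∀ {e} → e ∈ d ∷ ds → e ≢ d → e ∈ rest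
    ∈rest (here e≡d)   e≢d = contradiction e≡d e≢d
    ∈rest (there e∈ds) e≢d = ∈-─ e∈ds d∈ds e≢d
    label′ : Fin n → ℕ
    label′ e with e ≟ d
    ... | yes _ = h
    ... | no _  = label e
    label<′ : ∀ {e} → e ∈ d ∷ ds → label′ e < suc h
    label<′ {e} e∈ with e ≟ d
    ... | yes _   = n<1+n h
    ... | no e≢d = m<n⇒m<1+n (label< (∈rest e∈ e≢d))
    injective : ∀ {e e'} → e ∈ d ∷ ds → e' ∈ d ∷ ds → label′ e ≡ label′ e' → e ≡ e'
    injective {e} {e'} e∈ e'∈ eq with e ≟ d | e' ≟ d
    ... | yes e≡d | yes e'≡d = trans e≡d (sym e'≡d)
    ... | yes _   | no e'≢d = contradiction (sym eq) (<⇒≢ (label< (∈rest e'∈ e'≢d)))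
    ... | no e≢d  | yes _   = contradiction eq (<⇒≢ (label< (∈rest e∈ e≢d)))
    ... | no e≢d  | no e'≢d = label-injective (∈rest e∈ e≢d) (∈rest e'∈ e'≢d) eq

¬¬-∀Fin : ∀ {m} {A : Fin m → Set} → (∀ i → ¬ ¬ A i) → ¬ ¬ (∀ i → A i)
¬¬-∀Fin {zero}  _   ¬∀A = ¬∀A λ ()
¬¬-∀Fin {suc m} ¬¬A ¬∀A =
  ¬¬A fzero λ a₀ → ¬¬-∀Fin (¬¬A ∘ fsuc) λ as → ¬∀A λ { fzero → a₀ ; (fsuc i) → as i }

module LeafOrder {k : ℕ} {Adj : Fin (suc k) → Fin (suc k) → Set}
  (simple : TreeDefs.IsSimpleGraph Adj) (leaf : TreeDefs.IsLeafOrdering Adj) where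
  open TreeDefs Adj

  parent : Fin k → Fin (suc k)
  parent t = proj₁ (leaf t)

  parent< : ∀ t → toℕ (parent t) < toℕ (fsuc t)
  parent< t = proj₁ (proj₂ (leaf t))

  parent-unique : ∀ t q → toℕ q < toℕ (fsuc t) → Adj q (fsuc t) → q ≡ parent t
  parent-unique t = proj₂ (proj₂ (proj₂ (leaf t)))

  Joins : Fin k → Fin (suc k) → Fin (suc k) → Set
  Joins t u w = (u ≡ parent t × w ≡ fsuc t) ⊎ (w ≡ parent t × u ≡ fsuc t)

  ∈e-cases : ∀ {w t} → w ∈e t → w ≡ fsuc t ⊎ w ≡ parent t
  ∈e-cases         (inj₁ w≡t)          = inj₁ w≡t
  ∈e-cases {w} {t} (inj₂ (w<t , w~t)) = inj₂ (parent-unique t w w<t w~t)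

  parent-∈e : ∀ t → parent t ∈e t
  parent-∈e t = inj₂ (parent< t , proj₁ (proj₂ (proj₂ (leaf t))))

  joins-∈e : ∀ {t u w} → Joins t u w → u ∈e t × w ∈e t
  joins-∈e {t} (inj₁ (refl , refl)) = parent-∈e t , inj₁ refl
  joins-∈e {t} (inj₂ (refl , refl)) = inj₁ refl , parent-∈e t

  ∈e-joins : ∀ {t u w} → u ≢ w → u ∈e t → w ∈e t → Joins t u w
  ∈e-joins u≢w u∈ w∈ with ∈e-cases u∈ | ∈e-cases w∈
  ... | inj₁ refl | inj₁ refl = contradiction refl u≢w
  ... | inj₂ refl | inj₂ refl = contradiction refl u≢w
  ... | inj₁ u≡   | inj₂ w≡   = inj₂ (w≡ , u≡)
  ... | inj₂ u≡   | inj₁ w≡   = inj₁ (u≡ , w≡)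

  adj⇒joins : ∀ {u w} → Adj u w → ∃ λ t → Joins t u w
  adj⇒joins {u} {w} u~w with <-cmp (toℕ u) (toℕ w)
  ... | tri≈ _ u≡w _ = contradiction (subst (Adj u) (sym (toℕ-injective u≡w)) u~w) (proj₂ simple u)
  adj⇒joins {u} {fsuc t} u~w | tri< u<w _ _ = t , inj₁ (parent-unique t u u<w u~w , refl)
  adj⇒joins {fsuc t} {w} u~w | tri> _ _ w<u =
    t , inj₂ (parent-unique t w w<u (proj₁ simple _ _ u~w) , refl)

  joins-same : ∀ {t u w u' w'} → Joins t u w → Joins t u' w' →
    (u ≡ u' × w ≡ w') ⊎ (u ≡ w' × w ≡ u')
  joins-same (inj₁ (refl , refl)) (inj₁ (refl , refl)) = inj₁ (refl , refl)
  joins-same (inj₁ (refl , refl)) (inj₂ (refl , refl)) = inj₂ (refl , refl)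
  joins-same (inj₂ (refl , refl)) (inj₁ (refl , refl)) = inj₂ (refl , refl)
  joins-same (inj₂ (refl , refl)) (inj₂ (refl , refl)) = inj₁ (refl , refl)

module GreedyEmbedding
  {k : ℕ} {Adj : Fin (suc k) → Fin (suc k) → Set}
  (simple : TreeDefs.IsSimpleGraph Adj) (leaf : TreeDefs.IsLeafOrdering Adj)
  {H₀ : Fin k → Fin k → Bool} (H₀-graph : TreeDefs.HDefs.H₀Graph Adj H₀)
  {n : ℕ} {V' : Cube n → Bool} {E' : Cube n → Fin n → Bool}
  (subgraph : SubcubeDefs.IsSubgraph V' E')
  {C : Set} {c : Cube n → Fin n → C}
  (well-defined : SubcubeDefs.ColDefs.WellDefined V' E' c)
  (proper : SubcubeDefs.ColDefs.Proper V' E' c)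
  where
  open TreeDefs Adj
  open HDefs H₀
  open LeafOrder simple leaf
  open SubcubeDefs V' E' using (degree)

  colour : (Fin (suc k) → Cube n) → (Fin k → Fin n) → Fin k → C
  colour φ dir t = c (φ (parent t)) (dir t)

  record Embeds (J : ℕ) (φ : Fin (suc k) → Cube n) (dir : Fin k → Fin n) : Set where
    field
      along     : ∀ t → toℕ t < J → φ (fsuc t) ≡ flip (φ (parent t)) (dir t)
      present   : ∀ t → toℕ t < J → E' (φ (parent t)) (dir t) ≡ true
      rainbow   : ∀ {t t'} → toℕ t < J → toℕ t' < J → t ≢ t' → colour φ dir t ≢ colour φ dir t'
      separated : ∀ {t t'} → toℕ t < J → toℕ t' < J → H₀ t t' ≡ true → dir t ≢ dir t'
      inside    : ∀ u → toℕ u ≤ J → V' (φ u) ≡ true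

  colour-unique : ∀ {x d d'} → E' x d ≡ true → E' x d' ≡ true → c x d ≡ c x d' → d ≡ d'
  colour-unique {x} {d} {d'} Ed Ed' same with d ≟ d'
  ... | yes d≡d' = d≡d'
  ... | no d≢d' = contradiction same (proper x d d' d≢d' Ed Ed')

  chromatic-even : ChromaticCondition → ∀ {L} ℓ → L ≡ 2 * ℓ → (v : Fin (suc L) → Fin (suc k)) →
    v fzero ≢ v (fromℕ L) → IsPath L v → ¬ PathEdgesColourable L v ℓ
  chromatic-even _         zero    refl v ends-distinct = contradiction refl ends-distinct
  chromatic-even chromatic (suc ℓ) refl v _             = chromatic (suc ℓ) (s≤s z≤n) v

  parent≤ : ∀ {J t} → toℕ t < J → toℕ (parent t) ≤ J
  parent≤ {t = t} t<J = ≤-trans (≤-pred (parent< t)) (<⇒≤ t<J)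

  module Extension {J} (J<k : J < k) {φ dir} (I : Embeds J φ dir) where
    open Embeds I

    i : Fin k
    i = fromℕ< J<k

    toℕi : toℕ i ≡ J
    toℕi = toℕ-fromℕ< J<k

    y : Cube n
    y = φ (parent i)

    parent-i≤J : toℕ (parent i) ≤ J
    parent-i≤J = subst (toℕ (parent i) ≤_) toℕi (≤-pred (parent< i))

    Fresh : Fin n → Set
    Fresh d = E' y d ≡ true
            × (∀ t → toℕ t < J → c y d ≢ colour φ dir t)
            × (∀ t → toℕ t < J → H₀ t i ≡ true → d ≢ dir t)

    -- at most J colours and k ∸ (J + 1) directions are excluded, but y has degree at least k
    fresh : DegreeCondition → (∀ x → V' x ≡ true → k ≤ degree x) →
      (∀ t → Dec (∃ λ d → E' y d ≡ true × c y d ≡ colour φ dir t)) → ∃ Fresh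
    fresh degree-condition min-degree owner? = d , Ed , colour-fresh , direction-fresh
      where
      earlier : Fin k → Bool
      earlier t = if toℕ t <ᵇ toℕ i then H₀ t i else false
      claimed banned : Fin k → Maybe (Fin n)
      claimed t = if toℕ t <ᵇ J then map proj₁ (dec⇒maybe (owner? t)) else nothing
      banned  t = if earlier t then just (dir t) else nothing
      forbidden : List (Fin n)
      forbidden = catMaybes (tabulate claimed) ++ catMaybes (tabulate banned)
      few : length forbidden < degree y
      few = begin-strict
        length forbidden
          ≡⟨ length-++ (catMaybes (tabulate claimed)) ⟩
        length (catMaybes (tabulate claimed)) + length (catMaybes (tabulate banned))
          ≡⟨ cong₂ _+_ (length-catMaybes-tabulate k claimed) (length-catMaybes-tabulate k banned) ⟩
        count k (is-just ∘ claimed) + count k (is-just ∘ banned)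
          ≤⟨ +-mono-≤ (count-mono k λ t → is-just-guarded (toℕ t <ᵇ J))
                      (count-mono k λ t → is-just-guarded (earlier t)) ⟩
        count k (λ t → toℕ t <ᵇ J) + count k earlier
          ≤⟨ +-mono-≤ (≤-reflexive (count-<ᵇ k J (<⇒≤ J<k))) (degree-condition i) ⟩
        J + (k ∸ suc (toℕ i))
          ≡⟨ cong (λ j → J + (k ∸ suc j)) toℕi ⟩
        J + (k ∸ suc J)
          <⟨ n<1+n _ ⟩
        suc J + (k ∸ suc J)
          ≡⟨ m+[n∸m]≡n J<k ⟩
        k
          ≤⟨ min-degree y (inside (parent i) parent-i≤J) ⟩
        degree y ∎
        where open ≤-Reasoning
      chosen : ∃ λ d → E' y d ≡ true × d ∉ forbidden
      chosen = pigeonhole (E' y) forbidden few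
      d : Fin n
      d = proj₁ chosen
      Ed : E' y d ≡ true
      Ed = proj₁ (proj₂ chosen)
      d∉ : d ∉ forbidden
      d∉ = proj₂ (proj₂ chosen)
      colour-fresh : ∀ t → toℕ t < J → c y d ≢ colour φ dir t
      colour-fresh t t<J same = d∉ (∈-++⁺ˡ (∈-catMaybes-tabulate claimed t claimed≡d))
        where
        claimed≡d : claimed t ≡ just d
        claimed≡d rewrite <⇒<ᵇ≡true t<J with owner? t
        ... | yes (d' , Ed' , same') = cong just (colour-unique Ed' Ed (trans same' (sym same)))
        ... | no none = contradiction (d , Ed , same) none
      direction-fresh : ∀ t → toℕ t < J → H₀ t i ≡ true → d ≢ dir t
      direction-fresh t t<J H₀ti d≡ = d∉ (∈-++⁺ʳ _ (∈-catMaybes-tabulate banned t banned≡d))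
        where
        banned≡d : banned t ≡ just d
        banned≡d rewrite <⇒<ᵇ≡true (subst (toℕ t <_) (sym toℕi) t<J) | H₀ti = cong just (sym d≡)

    φ⁺ : Fin n → Fin (suc k) → Cube n
    φ⁺ d = updateAt φ (fsuc i) (const (flip y d))

    dir⁺ : Fin n → Fin k → Fin n
    dir⁺ d = updateAt dir i (const d)

    edge-split : ∀ {t} → toℕ t < suc J → t ≡ i ⊎ toℕ t < J
    edge-split {t} t≤J with t ≟ i
    ... | yes t≡i = inj₁ t≡i
    ... | no t≢i = inj₂ (≤∧≢⇒< (≤-pred t≤J) λ t≡J → t≢i (toℕ-injective (trans t≡J (sym toℕi))))

    vertex-split : ∀ {u} → toℕ u ≤ suc J → u ≡ fsuc i ⊎ toℕ u ≤ J
    vertex-split {u} u≤J+1 with u ≟ fsuc i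
    ... | yes u≡ = inj₁ u≡
    ... | no u≢ = inj₂ (≤-pred (≤∧≢⇒< u≤J+1 λ u≡ → u≢ (toℕ-injective (trans u≡ (cong suc (sym toℕi))))))

    module _ {d : Fin n} where
      φ⁺-new : φ⁺ d (fsuc i) ≡ flip y d
      φ⁺-new = updateAt-updates (fsuc i) φ

      φ⁺-old : ∀ {u} → toℕ u ≤ J → φ⁺ d u ≡ φ u
      φ⁺-old {u} u≤J =
        updateAt-minimal u (fsuc i) φ λ { refl → 1+n≰n (subst (_≤ J) (cong suc toℕi) u≤J) }

      dir⁺-new : dir⁺ d i ≡ d
      dir⁺-new = updateAt-updates i dir

      dir⁺-old : ∀ {t} → toℕ t < J → dir⁺ d t ≡ dir t
      dir⁺-old {t} t<J = updateAt-minimal t i dir λ { refl → <-irrefl toℕi t<J }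

      parent⁺-old : ∀ {t} → toℕ t < J → φ⁺ d (parent t) ≡ φ (parent t)
      parent⁺-old t<J = φ⁺-old (parent≤ t<J)

      colour⁺-old : ∀ {t} → toℕ t < J → colour (φ⁺ d) (dir⁺ d) t ≡ colour φ dir t
      colour⁺-old t<J = cong₂ c (parent⁺-old t<J) (dir⁺-old t<J)

      colour⁺-new : colour (φ⁺ d) (dir⁺ d) i ≡ c y d
      colour⁺-new = cong₂ c (φ⁺-old parent-i≤J) dir⁺-new

    extend : ∀ {d} → Fresh d → Embeds (suc J) (φ⁺ d) (dir⁺ d)
    Embeds.along (extend _) t t<J+1 with edge-split t<J+1
    ... | inj₁ refl = trans φ⁺-new (sym (cong₂ flip (φ⁺-old parent-i≤J) dir⁺-new))
    ... | inj₂ t<J = trans (φ⁺-old t<J)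
      (trans (along t t<J) (sym (cong₂ flip (parent⁺-old t<J) (dir⁺-old t<J))))
    Embeds.present (extend (Ed , _)) t t<J+1 with edge-split t<J+1
    ... | inj₁ refl = trans (cong₂ E' (φ⁺-old parent-i≤J) dir⁺-new) Ed
    ... | inj₂ t<J = trans (cong₂ E' (parent⁺-old t<J) (dir⁺-old t<J)) (present t t<J)
    Embeds.rainbow (extend (_ , colour-fresh , _)) t<J+1 t'<J+1 t≢t'
      with edge-split t<J+1 | edge-split t'<J+1
    ... | inj₁ refl | inj₁ refl = contradiction refl t≢t'
    ... | inj₁ refl | inj₂ t'<J = λ same →
      colour-fresh _ t'<J (trans (sym colour⁺-new) (trans same (colour⁺-old t'<J)))
    ... | inj₂ t<J  | inj₁ refl = λ same →
      colour-fresh _ t<J (trans (sym colour⁺-new) (trans (sym same) (colour⁺-old t<J)))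
    ... | inj₂ t<J  | inj₂ t'<J = λ same →
      rainbow t<J t'<J t≢t' (trans (sym (colour⁺-old t<J)) (trans same (colour⁺-old t'<J)))
    Embeds.separated (extend (_ , _ , direction-fresh)) {t} {t'} t<J+1 t'<J+1 H₀tt'
      with edge-split t<J+1 | edge-split t'<J+1
    ... | inj₁ refl | inj₁ refl = contradiction (trans (sym (proj₂ H₀-graph t)) H₀tt') λ ()
    ... | inj₁ refl | inj₂ t'<J = λ same →
      direction-fresh t' t'<J (trans (sym (proj₁ H₀-graph t t')) H₀tt')
        (trans (sym dir⁺-new) (trans same (dir⁺-old t'<J)))
    ... | inj₂ t<J  | inj₁ refl = λ same →
      direction-fresh t t<J H₀tt' (trans (sym dir⁺-new) (trans (sym same) (dir⁺-old t<J)))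
    ... | inj₂ t<J  | inj₂ t'<J = λ same →
      separated t<J t'<J H₀tt' (trans (sym (dir⁺-old t<J)) (trans same (dir⁺-old t'<J)))
    Embeds.inside (extend {d} (Ed , _)) u u≤J+1 with vertex-split u≤J+1
    ... | inj₁ refl = subst (λ z → V' z ≡ true) (sym φ⁺-new)
      (proj₂ subgraph (flip y d) d (trans (sym (proj₁ subgraph y d)) Ed))
    ... | inj₂ u≤J = trans (cong V' (φ⁺-old u≤J)) (inside u u≤J)

  module Construction (degree-condition : DegreeCondition)
    (min-degree : ∀ x → V' x ≡ true → k ≤ degree x) {x₀ : Cube n} (x₀∈V' : V' x₀ ≡ true) where

    -- only dir t with toℕ t < J is ever read, so any direction serves initially
    some-direction : Fin k → Fin n
    some-direction t =
      proj₁ (count-pos n (E' x₀) (≤-trans (m<n⇒0<n (toℕ<n t)) (min-degree x₀ x₀∈V')))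

    initial : Embeds 0 (const x₀) some-direction
    initial = record
      { along = λ _ () ; present = λ _ () ; rainbow = λ ()
      ; separated = λ () ; inside = λ _ _ → x₀∈V' }

    -- telling which edge at y carries a used colour needs excluded middle for colour equality;
    -- it holds under ¬¬, which suffices since the theorem only uses the embedding to reach ⊥
    embedding : ∀ J → J ≤ k → ¬ ¬ (∃ λ φ → ∃ λ dir → Embeds J φ dir)
    embedding zero    _   = pure (const x₀ , some-direction , initial)
    embedding (suc J) J<k = do
      (φ , dir , I) ← embedding J (<⇒≤ J<k)
      owner? ← ¬¬-∀Fin λ _ → ¬¬-excluded-middle
      let open Extension J<k I
          (d , fr) = fresh degree-condition min-degree owner?
      pure (φ⁺ d , dir⁺ d , extend fr)

  module Complete {φ dir} (I : Embeds k φ dir) where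
    open Embeds I

    joins-flip : ∀ {t u w} → Joins t u w → φ w ≡ flip (φ u) (dir t)
    joins-flip {t} (inj₁ (refl , refl)) = along t (toℕ<n t)
    joins-flip {t} (inj₂ (refl , refl)) = flip-sym (dir t) (along t (toℕ<n t))

    joins-present : ∀ {t u w} → Joins t u w → E' (φ u) (dir t) ≡ true
    joins-present {t} (inj₁ (refl , refl)) = present t (toℕ<n t)
    joins-present {t} (inj₂ (refl , refl)) = begin
      E' (φ (fsuc t)) (dir t)                    ≡⟨ cong (λ z → E' z (dir t)) (along t (toℕ<n t)) ⟩
      E' (flip (φ (parent t)) (dir t)) (dir t)   ≡⟨ proj₁ subgraph _ _ ⟨
      E' (φ (parent t)) (dir t)                  ≡⟨ present t (toℕ<n t) ⟩
      true                                       ∎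
      where open ≡-Reasoning

    colour-at : ∀ {w t} → w ∈e t → colour φ dir t ≡ c (φ w) (dir t)
    colour-at {w} {t} w∈ with ∈e-cases w∈
    ... | inj₂ refl = refl
    ... | inj₁ refl = trans (well-defined _ _ (present t (toℕ<n t)))
                            (cong (λ z → c z (dir t)) (sym (along t (toℕ<n t))))

    joins-colour : ∀ {t u w d} → Joins t u w → φ w ≡ flip (φ u) d → colour φ dir t ≡ c (φ u) d
    joins-colour {t} {u} J φw≡ = trans (colour-at (proj₁ (joins-∈e J)))
      (cong (c (φ u)) (flip-injective (φ u) (trans (sym (joins-flip J)) φw≡)))

    H-adjacent⇒dir≢ : ∀ {i j} → HAdj i j → dir i ≢ dir j
    H-adjacent⇒dir≢ {i} {j} (inj₁ H₀ij) = separated (toℕ<n i) (toℕ<n j) H₀ij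
    H-adjacent⇒dir≢ {i} {j} (inj₂ (i≢j , w , w∈i , w∈j)) same =
      rainbow (toℕ<n i) (toℕ<n j) i≢j
        (trans (colour-at w∈i) (trans (cong (c (φ w)) same) (sym (colour-at w∈j))))

    closed-path-colourable : ∀ L v → IsPath L v → φ (v fzero) ≡ φ (v (fromℕ L)) →
      Σ ℕ λ ℓ → (L ≡ 2 * ℓ) × PathEdgesColourable L v ℓ
    closed-path-colourable L v (v-injective , v-adj) closed = half , L≡ , col , proper-col
      where
      step : ∀ a → ∃ λ t → Joins t (v (inject₁ a)) (v (fsuc a))
      step a = adj⇒joins (v-adj a)
      dirs : Fin L → Fin n
      dirs a = dir (proj₁ (step a))
      step-flip : ∀ a → φ (v (fsuc a)) ≡ flip (φ (v (inject₁ a))) (dirs a)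
      step-flip a = joins-flip (proj₂ (step a))
      even : EvenOccurrences (tabulate dirs)
      even = closed-walk⇒even _ (tabulate dirs)
        (sym (trans closed (walk-along L (φ ∘ v) dirs step-flip)))
      open Halvable (even⇒halvable (tabulate dirs) even)
      L≡ : L ≡ 2 * half
      L≡ = trans (sym (length-tabulate dirs)) length≡
      dirs∈ : ∀ a → dirs a ∈ tabulate dirs
      dirs∈ a = tabulate⁺ a refl
      col : Fin L → Fin half
      col a = fromℕ< (label< (dirs∈ a))
      edge-dir : ∀ {a i} → EdgeAt L v a i → dirs a ≡ dir i
      edge-dir {a} (u∈ , w∈) = flip-injective (φ (v (inject₁ a)))
        (trans (sym (step-flip a)) (joins-flip (∈e-joins ends-distinct u∈ w∈)))
        where
        ends-distinct : v (inject₁ a) ≢ v (fsuc a)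
        ends-distinct = 1+n≢n ∘ sym ∘ trans (sym (toℕ-inject₁ a)) ∘ cong toℕ ∘ v-injective _ _
      proper-col : ∀ a b i j → a ≢ b → EdgeAt L v a i → EdgeAt L v b j → HAdj i j → col a ≢ col b
      proper-col a b i j _ a∼i b∼j Hij same = H-adjacent⇒dir≢ Hij (begin
        dir i   ≡⟨ edge-dir a∼i ⟨
        dirs a  ≡⟨ label-injective (dirs∈ a) (dirs∈ b) (begin
                     label (dirs a)     ≡⟨ toℕ-fromℕ< _ ⟨
                     toℕ (col a)        ≡⟨ cong toℕ same ⟩
                     toℕ (col b)        ≡⟨ toℕ-fromℕ< _ ⟩
                     label (dirs b)     ∎) ⟩
        dirs b  ≡⟨ edge-dir b∼j ⟩
        dir j   ∎)
        where open ≡-Reasoning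

    rainbow-copy : Connected → ChromaticCondition → SubcubeDefs.ColDefs.RainbowCopy V' E' c Adj
    rainbow-copy connected chromatic = φ , injective , edges , distinct-colours
      where
      injective : ∀ u w → φ u ≡ φ w → u ≡ w
      injective u w φu≡φw with u ≟ w | connected u w
      ... | yes u≡w | _ = u≡w
      ... | no u≢w | L , v , path , refl , refl =
        let ℓ , L≡ , colouring = closed-path-colourable L v path φu≡φw
        in ⊥-elim (chromatic-even chromatic ℓ L≡ v u≢w path colouring)
      edges : ∀ u w → Adj u w → Σ (Fin n) λ d → (φ w ≡ flip (φ u) d) × (E' (φ u) d ≡ true)
      edges u w u~w = let t , J = adj⇒joins u~w in dir t , joins-flip J , joins-present J
      distinct-colours : ∀ u w u' w' d d' → Adj u w → Adj u' w' →
        ¬ (((u ≡ u') × (w ≡ w')) ⊎ ((u ≡ w') × (w ≡ u'))) →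
        φ w ≡ flip (φ u) d → φ w' ≡ flip (φ u') d' → c (φ u) d ≢ c (φ u') d'
      distinct-colours u w u' w' d d' u~w u'~w' different φw≡ φw'≡ same
        with adj⇒joins u~w | adj⇒joins u'~w'
      ... | t , J | t' , J' with t ≟ t'
      ... | yes refl = different (joins-same J J')
      ... | no t≢t' = rainbow (toℕ<n t) (toℕ<n t') t≢t'
        (trans (joins-colour J φw≡) (trans same (sym (joins-colour J' φw'≡))))

  ¬¬rainbow-copy : DegreeCondition → Connected → ChromaticCondition →
    (∀ x → V' x ≡ true → k ≤ degree x) → ∀ {x₀} → V' x₀ ≡ true →
    ¬ ¬ SubcubeDefs.ColDefs.RainbowCopy V' E' c Adj
  ¬¬rainbow-copy degree-condition connected chromatic min-degree x₀∈V' =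
    ¬¬-map (λ (_ , _ , I) → Complete.rainbow-copy I connected chromatic)
           (Construction.embedding degree-condition min-degree x₀∈V' k ≤-refl)

lemma3p2 : (k : ℕ) (Adj : Fin (suc k) → Fin (suc k) → Set) →
    TreeDefs.IsTree Adj → TreeDefs.IsLeafOrdering Adj →
    (H₀ : Fin k → Fin k → Bool) →
    TreeDefs.HDefs.H₀Graph Adj H₀ →
    TreeDefs.HDefs.DegreeCondition Adj H₀ →
    TreeDefs.HDefs.ChromaticCondition Adj H₀ →
    (n : ℕ) (V' : Cube n → Bool) (E' : Cube n → Fin n → Bool) →
    SubcubeDefs.IsSubgraph V' E' →
    Σ (Cube n) (λ x → V' x ≡ true) →
    (C : Set) (c : Cube n → Fin n → C) →
    SubcubeDefs.ColDefs.WellDefined V' E' c →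
    SubcubeDefs.ColDefs.Proper V' E' c →
    ¬ SubcubeDefs.ColDefs.RainbowCopy V' E' c Adj →
    Σ (Cube n) (λ x → (V' x ≡ true) × (SubcubeDefs.degree V' E' x < k))
lemma3p2 k Adj (simple , connected , _) leaf H₀ H₀-graph degree-condition chromatic
         n V' E' subgraph (x₀ , x₀∈V') C c well-defined proper no-copy
  with anySubset? (λ x → (V' x ≟ᵇ true) ×-dec (SubcubeDefs.degree V' E' x <? k))
... | yes low-degree = low-degree
... | no ¬low-degree =
  ⊥-elim (¬¬rainbow-copy degree-condition connected chromatic min-degree x₀∈V' no-copy)
  where
  open GreedyEmbedding simple leaf H₀-graph subgraph well-defined proper
  min-degree : ∀ x → V' x ≡ true → k ≤ SubcubeDefs.degree V' E' x
  min-degree x x∈V' = ≮⇒≥ λ low → ¬low-degree (x , x∈V' , low)
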